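{- Let $T$ be a finite tree with at least two vertices and a proper 2-coloring $\chi:V(T)\to\{\mathcal{R},\mathcal{B}\}$. The following are equivalent: (1) $T$ is balanced; (2) any two vertices of the same height have the same color under $\chi$; (3) every leaf has the same color under $\chi$.
   Context: A leaf is a vertex of degree 1; the height of a vertex is its minimum distance to a leaf. A tree is balanced if no two vertices of the same height are adjacent. A proper 2-coloring assigns different colors to adjacent vertices. -}

module Defs where

open import Data.Nat using (ℕ; zero; suc; _≤_; _≥_)
open import Data.Fin using (Fin)
open import Data.Bool using (Bool; true; false)
open import Data.List using (List; []; _∷_; length; filterᵇ; allFin)
open import Data.List.Relation.Unary.Unique.Propositional using (Unique)
open import Data.Empty using (⊥)
open import Data.Product using (Σ; ∃; ∃-syntax; _×_; _,_)
open import Relation.Binary.PropositionalEquality using (_≡_; _≢_)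
open import Relation.Nullary using (¬_)

record Graph (n : ℕ) : Set where
  field
    adj   : Fin n → Fin n → Bool
    sym   : ∀ u v → adj u v ≡ adj v u
    irref : ∀ v → adj v v ≡ false

module _ {n : ℕ} (G : Graph n) where
  open Graph G

  Adj : Fin n → Fin n → Set
  Adj u v = adj u v ≡ true

  data Walk : Fin n → Fin n → ℕ → Set where
    here : ∀ {v} → Walk v v zero
    step : ∀ {u w v k} → Adj u w → Walk w v k → Walk u v (suc k)

  Connected : Set
  Connected = ∀ u v → ∃[ k ] Walk u v k

  data Chain : List (Fin n) → Set where
    single : ∀ {v} → Chain (v ∷ [])
    link   : ∀ {u w vs} → Adj u w → Chain (w ∷ vs) → Chain (u ∷ w ∷ vs)

  lastOf : Fin n → List (Fin n) → Fin n
  lastOf x []       = x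
  lastOf x (y ∷ ys) = lastOf y ys

  IsCycle : List (Fin n) → Set
  IsCycle []                   = ⊥
  IsCycle (_ ∷ [])             = ⊥
  IsCycle (_ ∷ _ ∷ [])         = ⊥
  IsCycle (u ∷ v ∷ w ∷ vs)     =
    Unique (u ∷ v ∷ w ∷ vs) × Chain (u ∷ v ∷ w ∷ vs) × Adj (lastOf w vs) u

  Acyclic : Set
  Acyclic = ∀ cs → ¬ IsCycle cs

  IsTree : Set
  IsTree = Connected × Acyclic

  degree : Fin n → ℕ
  degree v = length (filterᵇ (adj v) (allFin n))

  Leaf : Fin n → Set
  Leaf v = degree v ≡ 1

  Height : Fin n → ℕ → Set
  Height v h =
    (∃[ l ] (Leaf l × Walk v l h)) ×
    (∀ l k → Leaf l → Walk v l k → h ≤ k)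

  Balanced : Set
  Balanced = ∀ u v h → Height u h → Height v h → ¬ Adj u v

  ProperColoring : (Fin n → Bool) → Set
  ProperColoring χ = ∀ u v → Adj u v → χ u ≢ χ v

-- A proper 2-colouring switches colour along every edge, so a walk of length k from u
-- to v gives χ v = χ u xor parity k.  Walking from a vertex of height h to a nearest
-- leaf shows that χ v xor parity h is the colour of a leaf, which yields (3) ⇒ (2);
-- (2) ⇒ (1) because adjacent vertices have different colours, and (2) ⇒ (3) because
-- leaves have height 0.  For (1) ⇒ (3): the heights of adjacent vertices always differ
-- by at most one, hence in a balanced tree by exactly one, so χ v xor parity (height v)
-- is constant along edges and therefore, by connectivity, on all vertices; on leaves it
-- is the colour.
module Submission where

open import Defs
open import Data.Nat using (ℕ; zero; suc; _≤_; _≥_; z≤n; s≤s)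
open import Data.Nat.Properties using (≤-antisym)
import Data.Nat.Properties as ℕ
open import Data.Fin using (Fin)
open import Data.Fin.Properties using (any?)
open import Data.Bool using (Bool; false; true; not; _xor_)
open import Data.Bool.Properties
  using (¬-not; not-involutive; not-distribˡ-xor; not-distribʳ-xor; xor-assoc; xor-same; xor-identityʳ)
import Data.Bool.Properties as Bool
open import Data.Sum using (_⊎_; inj₁; inj₂)
import Data.Sum as Sum
open import Data.Product using (_×_; _,_; ∃; ∃-syntax)
open import Function using (_∘_)
open import Function.Bundles using (_⇔_; mk⇔)
open import Relation.Binary.PropositionalEquality
  using (_≡_; _≢_; refl; sym; trans; cong; ≢-sym; module ≡-Reasoning)
open import Relation.Nullary using (Dec; yes; no; contradiction)
open import Relation.Nullary.Decidable using (_×-dec_)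

open ≡-Reasoning

parity : ℕ → Bool
parity zero    = false
parity (suc k) = not (parity k)

parity-flip : ∀ {a b} → a ≡ suc b ⊎ b ≡ suc a → parity a ≡ not (parity b)
parity-flip (inj₁ refl)     = refl
parity-flip {a} (inj₂ refl) = sym (not-involutive (parity a))

m≤1+n⇒n≤1+m⇒m≢n⇒m≡1+n⊎n≡1+m : ∀ {m n} → m ≤ suc n → n ≤ suc m → m ≢ n →
                                m ≡ suc n ⊎ n ≡ suc m
m≤1+n⇒n≤1+m⇒m≢n⇒m≡1+n⊎n≡1+m {zero}        {zero}        _ _ m≢n = contradiction refl m≢n
m≤1+n⇒n≤1+m⇒m≢n⇒m≡1+n⊎n≡1+m {zero}        {suc zero}    _ _ _   = inj₂ refl
m≤1+n⇒n≤1+m⇒m≢n⇒m≡1+n⊎n≡1+m {zero}        {suc (suc _)} _ (s≤s ()) _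
m≤1+n⇒n≤1+m⇒m≢n⇒m≡1+n⊎n≡1+m {suc zero}    {zero}        _ _ _   = inj₁ refl
m≤1+n⇒n≤1+m⇒m≢n⇒m≡1+n⊎n≡1+m {suc (suc _)} {zero}        (s≤s ()) _ _
m≤1+n⇒n≤1+m⇒m≢n⇒m≡1+n⊎n≡1+m {suc _}       {suc _}       (s≤s m≤1+n) (s≤s n≤1+m) m≢n =
  Sum.map (cong suc) (cong suc) (m≤1+n⇒n≤1+m⇒m≢n⇒m≡1+n⊎n≡1+m m≤1+n n≤1+m (m≢n ∘ cong suc))

least-witness : {P : ℕ → Set} → (∀ k → Dec (P k)) → ∀ {k} → P k →
                ∃[ h ] (P h × (∀ {j} → P j → h ≤ j))
least-witness P? {zero} P0 = zero , P0 , λ _ → z≤n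
least-witness {P} P? {suc _} Pk with P? zero
... | yes P0  = zero , P0 , λ _ → z≤n
... | no ¬P0 with least-witness (P? ∘ suc) Pk
...   | h , Ph , h-least = suc h , Ph , 1+h-least
  where
  1+h-least : ∀ {j} → P j → suc h ≤ j
  1+h-least {zero}  P0 = contradiction P0 ¬P0
  1+h-least {suc j} Pj = s≤s (h-least Pj)

xor-cancelʳ-self : ∀ x p → (x xor p) xor p ≡ x
xor-cancelʳ-self x p = begin
  (x xor p) xor p ≡⟨ xor-assoc x p p ⟩
  x xor (p xor p) ≡⟨ cong (x xor_) (xor-same p) ⟩
  x xor false     ≡⟨ xor-identityʳ x ⟩
  x               ∎

xor-cancelʳ : ∀ p {x y} → x xor p ≡ y xor p → x ≡ y
xor-cancelʳ p {x} {y} eq = begin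
  x               ≡⟨ sym (xor-cancelʳ-self x p) ⟩
  (x xor p) xor p ≡⟨ cong (_xor p) eq ⟩
  (y xor p) xor p ≡⟨ xor-cancelʳ-self y p ⟩
  y               ∎

not-xor-not : ∀ x y → not x xor not y ≡ x xor y
not-xor-not x y = begin
  not x xor not y     ≡⟨ sym (not-distribˡ-xor x (not y)) ⟩
  not (x xor not y)   ≡⟨ cong not (sym (not-distribʳ-xor x y)) ⟩
  not (not (x xor y)) ≡⟨ not-involutive (x xor y) ⟩
  x xor y             ∎

xor-flip : ∀ {x y p q} → x ≡ not y → p ≡ not q → x xor p ≡ y xor q
xor-flip {y = y} {q = q} refl refl = not-xor-not y q

module _ {n : ℕ} (G : Graph n) where

  LevelsMonochromatic : (Fin n → Bool) → Set
  LevelsMonochromatic χ = ∀ u v h → Height G u h → Height G v h → χ u ≡ χ v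

  LeavesMonochromatic : (Fin n → Bool) → Set
  LeavesMonochromatic χ = ∀ u v → Leaf G u → Leaf G v → χ u ≡ χ v

  ReachesLeafIn : Fin n → ℕ → Set
  ReachesLeafIn v k = ∃[ l ] (Leaf G l × Walk G v l k)

  Adj-sym : ∀ {u w} → Adj G u w → Adj G w u
  Adj-sym {u} {w} u~w = trans (sym (Graph.sym G u w)) u~w

  walk? : ∀ k u v → Dec (Walk G u v k)
  walk? zero u v with u Data.Fin.≟ v
  ... | yes refl = yes here
  ... | no u≢v   = no λ { here → u≢v refl }
  walk? (suc k) u v with any? (λ w → (Graph.adj G u w Bool.≟ true) ×-dec walk? k w v)
  ... | yes (w , u~w , W) = yes (step u~w W)
  ... | no ∄w             = no λ { (step {w = w} u~w W) → ∄w (w , u~w , W) }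

  reachesLeafIn? : ∀ v k → Dec (ReachesLeafIn v k)
  reachesLeafIn? v k = any? (λ l → (degree G l ℕ.≟ 1) ×-dec walk? k v l)

  height-exists : Connected G → ∀ {l} → Leaf G l → ∀ v → ∃ (Height G v)
  height-exists connected {l} leaf v with connected v l
  ... | _ , W with least-witness (reachesLeafIn? v) (l , leaf , W)
  ...   | h , reach , h-least = h , reach , λ l′ _ leaf′ W′ → h-least (l′ , leaf′ , W′)

  height-unique : ∀ {v a b} → Height G v a → Height G v b → a ≡ b
  height-unique ((l , leaf , W) , a-least) ((l′ , leaf′ , W′) , b-least) =
    ≤-antisym (a-least l′ _ leaf′ W′) (b-least l _ leaf W)

  leaf-height : ∀ {l} → Leaf G l → Height G l 0
  leaf-height {l} leaf = (l , leaf , here) , λ _ _ _ _ → z≤n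

  height-adjacent-≤ : ∀ {u w a b} → Adj G u w → Height G u a → Height G w b → a ≤ suc b
  height-adjacent-≤ u~w (_ , a-least) ((l , leaf , W) , _) = a-least l _ leaf (step u~w W)

  balanced-height-adjacent : Balanced G → ∀ {u w a b} → Adj G u w →
                             Height G u a → Height G w b → a ≡ suc b ⊎ b ≡ suc a
  balanced-height-adjacent balanced {u} {w} u~w Hu Hw =
    m≤1+n⇒n≤1+m⇒m≢n⇒m≡1+n⊎n≡1+m
      (height-adjacent-≤ u~w Hu Hw) (height-adjacent-≤ (Adj-sym u~w) Hw Hu)
      λ { refl → balanced u w _ Hu Hw u~w }

  module _ {χ : Fin n → Bool} (proper : ProperColoring G χ) where

    walk-colour : ∀ {u v k} → Walk G u v k → χ v ≡ χ u xor parity k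
    walk-colour {u} here = sym (xor-identityʳ (χ u))
    walk-colour {u} {v} (step {w = w} {k = k} u~w W) = begin
      χ v                     ≡⟨ walk-colour W ⟩
      χ w xor parity k        ≡⟨ cong (_xor parity k) (¬-not (≢-sym (proper u w u~w))) ⟩
      not (χ u) xor parity k  ≡⟨ sym (not-distribˡ-xor (χ u) (parity k)) ⟩
      not (χ u xor parity k)  ≡⟨ not-distribʳ-xor (χ u) (parity k) ⟩
      χ u xor parity (suc k)  ∎

    balanced-edge-invariant : Balanced G → ∀ {u w a b} → Adj G u w →
                              Height G u a → Height G w b → χ u xor parity a ≡ χ w xor parity b
    balanced-edge-invariant balanced {u} {w} u~w Hu Hw =
      xor-flip (¬-not (proper u w u~w)) (parity-flip (balanced-height-adjacent balanced u~w Hu Hw))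

    balanced-walk-invariant : Balanced G → (∀ v → ∃ (Height G v)) →
                              ∀ {u v k} → Walk G u v k → ∀ {a b} → Height G u a → Height G v b →
                              χ u xor parity a ≡ χ v xor parity b
    balanced-walk-invariant _ _ {u} here Ha Hb =
      cong (λ h → χ u xor parity h) (height-unique Ha Hb)
    balanced-walk-invariant balanced heights (step {w = w} u~w W) Ha Hb with heights w
    ... | _ , Hw = trans (balanced-edge-invariant balanced u~w Ha Hw)
                         (balanced-walk-invariant balanced heights W Hw Hb)

    balanced⇒leavesMonochromatic : Connected G → Balanced G → LeavesMonochromatic χ
    balanced⇒leavesMonochromatic connected balanced u v leaf-u leaf-v with connected u v
    ... | _ , W = xor-cancelʳ false
      (balanced-walk-invariant balanced (height-exists connected leaf-u) W
                               (leaf-height leaf-u) (leaf-height leaf-v))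

    leavesMonochromatic⇒levelsMonochromatic : LeavesMonochromatic χ → LevelsMonochromatic χ
    leavesMonochromatic⇒levelsMonochromatic mono u v h ((l , leaf , W) , _) ((l′ , leaf′ , W′) , _) =
      xor-cancelʳ (parity h) (begin
        χ u xor parity h ≡⟨ sym (walk-colour W) ⟩
        χ l              ≡⟨ mono l l′ leaf leaf′ ⟩
        χ l′             ≡⟨ walk-colour W′ ⟩
        χ v xor parity h ∎)

    levelsMonochromatic⇒balanced : LevelsMonochromatic χ → Balanced G
    levelsMonochromatic⇒balanced mono u v h Hu Hv u~v = proper u v u~v (mono u v h Hu Hv)

  levelsMonochromatic⇒leavesMonochromatic : ∀ {χ} → LevelsMonochromatic χ → LeavesMonochromatic χ
  levelsMonochromatic⇒leavesMonochromatic mono u v leaf-u leaf-v =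
    mono u v 0 (leaf-height leaf-u) (leaf-height leaf-v)

proposition3p5 : (n : ℕ) → n ≥ 2 → (G : Graph n) → IsTree G →
    (χ : Fin n → Bool) → ProperColoring G χ →
    (Balanced G ⇔ (∀ u v h → Height G u h → Height G v h → χ u ≡ χ v)) ×
    ((∀ u v h → Height G u h → Height G v h → χ u ≡ χ v) ⇔
      (∀ u v → Leaf G u → Leaf G v → χ u ≡ χ v))
proposition3p5 _ _ G (connected , _) χ proper =
  mk⇔ (leavesMonochromatic⇒levelsMonochromatic G proper
         ∘ balanced⇒leavesMonochromatic G proper connected)
      (levelsMonochromatic⇒balanced G proper) ,
  mk⇔ (levelsMonochromatic⇒leavesMonochromatic G)
      (leavesMonochromatic⇒levelsMonochromatic G proper)
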